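{- Let $p$ be a prime. Let $A_p$ be the set of all positive integers $n$ for which there exists a transitive permutation group of degree $n$ having no fixed-point-free element of $p$-power order. For each $b \in \mathbb{N}$ coprime to $p$, define $m_p(b) = \min\{c \in \mathbb{N}:\ p^a \cdot b \notin A_p \text{ for all } a \geq c\}$, with the convention that $m_p(b)=\infty$ if this set is empty. Then $m_p(b) > h_p(b)$ for all $b \in \mathbb{N}$ coprime to $p$.
   Context: For a prime power $q$ and $n \in \mathbb{N}$, let $\sigma:\mathbb{F}_q^n\to\mathbb{F}_q^n$ be the cyclic shift $\sigma(\sum_{i=1}^n x_i e_i)=\sum_{i=1}^n x_{i-1}e_i$ (indices mod $n$), where $e_1,\dots,e_n$ is the standard basis. A subspace $U\le \mathbb{F}_q^n$ is cyclically covering if $\bigcup_{r=0}^{n-1}\sigma^r(U)=\mathbb{F}_q^n$. $h_q(n)$ denotes the maximum possible codimension of a cyclically covering subspace of $\mathbb{F}_q^n$. A permutation group $G\le S_n$ has degree $n$ and is transitive if for all $i,j\in[n]$ some element maps $i$ to $j$. -}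

module Defs where

open import Data.Nat using (ℕ; zero; suc; _+_; _*_; _^_; _<_; NonZero)
open import Data.Nat.DivMod using (_mod_)
open import Data.Fin using (Fin; zero; suc; toℕ; fromℕ; inject₁)
open import Data.Fin.Permutation using (Permutation′; _⟨$⟩ʳ_; _⟨$⟩ˡ_)
open import Data.Product using (Σ; ∃; _×_; _,_)
open import Data.Empty using (⊥)
open import Relation.Nullary using (¬_)
open import Relation.Binary.PropositionalEquality using (_≡_; _≢_)

module _ (p : ℕ) .{{_ : NonZero p}} where

  F : Set
  F = Fin p

  0F : F
  0F = 0 mod p

  _+F_ : F → F → F
  a +F b = (toℕ a + toℕ b) mod p

  _*F_ : F → F → F
  a *F b = (toℕ a * toℕ b) mod p

  Vec : ℕ → Set
  Vec n = Fin n → F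

  _≈_ : ∀ {n} → Vec n → Vec n → Set
  x ≈ y = ∀ i → x i ≡ y i

  0V : ∀ {n} → Vec n
  0V _ = 0F

  _+V_ : ∀ {n} → Vec n → Vec n → Vec n
  (x +V y) i = x i +F y i

  _·V_ : ∀ {n} → F → Vec n → Vec n
  (c ·V x) i = c *F x i

  lincomb : ∀ {n} d → (Fin d → F) → (Fin d → Vec n) → Vec n
  lincomb zero    c v = 0V
  lincomb (suc d) c v = (c zero ·V v zero) +V lincomb d (λ j → c (suc j)) (λ j → v (suc j))

  record IsSubspace {n} (U : Vec n → Set) : Set where
    field
      respects : ∀ {x y} → x ≈ y → U x → U y
      has-0    : U 0V
      closed-+ : ∀ {x y} → U x → U y → U (x +V y)
      closed-· : ∀ c {x} → U x → U (c ·V x)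

  record IsBasis {n} (U : Vec n → Set) (d : ℕ) (v : Fin d → Vec n) : Set where
    field
      inU         : ∀ j → U (v j)
      independent : ∀ (c : Fin d → F) → lincomb d c v ≈ 0V → ∀ j → c j ≡ 0F
      spanning    : ∀ x → U x → Σ (Fin d → F) λ c → x ≈ lincomb d c v

  HasDim : ∀ {n} → (Vec n → Set) → ℕ → Set
  HasDim U d = Σ (Fin _ → Vec _) λ v → IsBasis U d v

  HasCodim : ∀ {n} → (Vec n → Set) → ℕ → Set
  HasCodim {n} U k = Σ ℕ λ d → HasDim U d × (d + k ≡ n)

-- Cyclic shift σ (x_1,…,x_n) = (x_n, x_1, …, x_{n-1}),  σ(x)_i = x_{i-1}

predC : ∀ {n} → Fin n → Fin n
predC {suc n} zero    = fromℕ n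
predC {suc n} (suc i) = inject₁ i

σ : ∀ {A : Set} {n} → (Fin n → A) → (Fin n → A)
σ x i = x (predC i)

σ^ : ∀ {A : Set} {n} → ℕ → (Fin n → A) → (Fin n → A)
σ^ zero    x = x
σ^ (suc r) x = σ (σ^ r x)

module _ (p : ℕ) .{{_ : NonZero p}} where

  CyclicallyCovering : ∀ {n} → (Vec p n → Set) → Set
  CyclicallyCovering {n} U =
    ∀ (x : Vec p n) → Σ ℕ λ r → r < n × Σ (Vec p n) λ u → U u × _≈_ p x (σ^ r u)

  -- k is the codimension of some cyclically covering subspace of F_p^n;
  -- h_p(n) is the maximum of all such k.
  CoveringCodim : ℕ → ℕ → Set₁
  CoveringCodim n k =
    Σ (Vec p n → Set) λ U → IsSubspace p U × CyclicallyCovering U × HasCodim p U k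

iter : ∀ {A : Set} → (A → A) → ℕ → A → A
iter f zero    a = a
iter f (suc m) a = f (iter f m a)

PowIsId : ∀ {n} → Permutation′ n → ℕ → Set
PowIsId g m = ∀ i → iter (g ⟨$⟩ʳ_) m i ≡ i

HasOrder : ∀ {n} → Permutation′ n → ℕ → Set
HasOrder g m = 0 < m × PowIsId g m × (∀ m′ → 0 < m′ → m′ < m → ¬ PowIsId g m′)

HasPPowerOrder : ℕ → ∀ {n} → Permutation′ n → Set
HasPPowerOrder p g = Σ ℕ λ a → HasOrder g (p ^ a)

FixedPointFree : ∀ {n} → Permutation′ n → Set
FixedPointFree g = ∀ i → g ⟨$⟩ʳ i ≢ i

record IsPermGroup {n} (G : Permutation′ n → Set) : Set where
  field
    respects : ∀ {g h} → (∀ i → g ⟨$⟩ʳ i ≡ h ⟨$⟩ʳ i) → G g → G h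
    has-id   : Σ (Permutation′ n) λ e → G e × (∀ i → e ⟨$⟩ʳ i ≡ i)
    closed-∘ : ∀ {g h} → G g → G h →
               Σ (Permutation′ n) λ k → G k × (∀ i → k ⟨$⟩ʳ i ≡ g ⟨$⟩ʳ (h ⟨$⟩ʳ i))
    closed-⁻¹ : ∀ {g} → G g →
               Σ (Permutation′ n) λ k → G k × (∀ i → k ⟨$⟩ʳ i ≡ g ⟨$⟩ˡ i)

IsTransitive : ∀ {n} → (Permutation′ n → Set) → Set
IsTransitive {n} G = ∀ (i j : Fin n) → Σ (Permutation′ n) λ g → G g × g ⟨$⟩ʳ i ≡ j

InA : ℕ → ℕ → Set₁
InA p n = 0 < n × Σ (Permutation′ n → Set) λ G →
  IsPermGroup G × IsTransitive G × (∀ g → G g → HasPPowerOrder p g → ¬ FixedPointFree g)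

module Submission where

-- Let U ≤ F_p^b be cyclically covering of codimension k and φ : F_p^b → F_p^k a linear
-- surjection killing U.  Pairs (r , v) ∈ ℤ_b × F_p^b act on the p^k·b points F_p^k × ℤ_b by
-- (w , t) ↦ (w + φ (rot_t v) , t + r), where rot_t shifts coordinates by t; these permutations
-- form a transitive group.  If such a permutation has p-power order then b ∣ p^a·r, so r ≡ 0
-- as b is prime to p; and since U is cyclically covering some rotation rot_t v lies in U, so
-- every point (w , t) is fixed.  Hence p^k·b ∈ A_p, and p^a·b ∉ A_p for all a ≥ c forces k < c.

open import Defs
open import Data.Nat using (ℕ; zero; suc; _+_; _*_; _∸_; _^_; _≤_; _<_; NonZero; _%_; ≢-nonZero; >-nonZero⁻¹; nonTrivial⇒n>1)
open import Data.Nat.Properties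
  using (_≤?_; ≰⇒>; m*n≢0; m^n≢0; +-suc; *-suc; +-identityʳ; +-assoc; +-comm; *-assoc; *-comm; *-identityˡ; *-distribˡ-+; m∸n+n≡m; <⇒≤)
open import Data.Nat.DivMod using (_mod_; m%n<n; m%n%n≡m%n; m<n⇒m%n≡m; %-distribˡ-+; %-distribˡ-*; [m+kn]%n≡m%n; m*n%n≡0)
open import Data.Nat.Divisibility using (_∣_; _∣0; ∣-refl; divides; m%n≡0⇒n∣m)
open import Data.Nat.Primality using (Prime; ¬prime[1]; prime⇒nonZero; prime⇒nonTrivial)
open import Data.Nat.Coprimality using (Coprime; coprime-divisor; coprime-Bézout; prime⇒coprime)
open import Data.Nat.GCD using (module Bézout)
open import Data.Fin using (Fin; zero; suc; toℕ; punchIn; punchOut; combine; quotient; remainder; funToFin; finToFun)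
open import Data.Fin.Properties
  using (toℕ-fromℕ; toℕ-inject₁; toℕ-fromℕ<; toℕ-injective; toℕ<n; punchIn-punchOut; any?; _≟_;
         remQuot-combine; combine-remQuot; funToFin-finToFin; finToFun-funToFin)
open import Data.Fin.Permutation using (Permutation′; permutation; _⟨$⟩ʳ_; _⟨$⟩ˡ_; inverseʳ)
open import Data.Vec.Functional using (_∷_; insertAt; removeAt)
open import Data.Vec.Functional.Properties using (insertAt-lookup; insertAt-punchIn)
open import Data.Product using (Σ; _,_; proj₁; proj₂; _×_)
open import Data.Empty using (⊥-elim)
open import Function using (_∘_)
open import Level using (0ℓ)
open import Algebra.Bundles using (CommutativeRing)
open import Algebra.Structures using (IsCommutativeRing)
open import Relation.Binary.Bundles using (Setoid)
open import Relation.Binary.PropositionalEquality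
open import Relation.Nullary using (¬_; yes; no; ¬?)
open import Relation.Nullary.Decidable using (decidable-stable)
import Relation.Binary.Reasoning.Setoid as SetoidReasoning

funToFin-cong : ∀ {m n} {f g : Fin m → Fin n} → (∀ j → f j ≡ g j) → funToFin f ≡ funToFin g
funToFin-cong {zero}  f≗g = refl
funToFin-cong {suc m} f≗g = cong₂ combine (f≗g zero) (funToFin-cong (f≗g ∘ suc))

iter-cong : ∀ {A : Set} {f g : A → A} → (∀ a → f a ≡ g a) → ∀ m a → iter f m a ≡ iter g m a
iter-cong f≗g zero    a = refl
iter-cong {g = g} f≗g (suc m) a = trans (f≗g _) (cong g (iter-cong f≗g m a))

coprime-divisor-^ : ∀ {b p r} → Coprime b p → ∀ a → b ∣ p ^ a * r → b ∣ r
coprime-divisor-^ {b} {r = r} cop zero    b∣r = subst (b ∣_) (*-identityˡ r) b∣r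
coprime-divisor-^ {b} {p} {r} cop (suc a) b∣pᵃ⁺¹r =
  coprime-divisor-^ cop a (coprime-divisor cop (subst (b ∣_) (*-assoc p (p ^ a) r) b∣pᵃ⁺¹r))

module Modular (m : ℕ) .{{_ : NonZero m}} where

  infix 4 _≡ₘ_

  -- A record rather than the bare equation, so that Agda can infer both sides.
  record _≡ₘ_ (x y : ℕ) : Set where
    constructor mk≡ₘ
    field %-≡ : x % m ≡ y % m
  open _≡ₘ_ public

  ≡ₘ-refl : ∀ {x} → x ≡ₘ x
  ≡ₘ-refl = mk≡ₘ refl

  ≡ₘ-reflexive : ∀ {x y} → x ≡ y → x ≡ₘ y
  ≡ₘ-reflexive x≡y = mk≡ₘ (cong (_% m) x≡y)

  ≡ₘ-sym : ∀ {x y} → x ≡ₘ y → y ≡ₘ x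
  ≡ₘ-sym (mk≡ₘ e) = mk≡ₘ (sym e)

  ≡ₘ-trans : ∀ {x y z} → x ≡ₘ y → y ≡ₘ z → x ≡ₘ z
  ≡ₘ-trans (mk≡ₘ e) (mk≡ₘ f) = mk≡ₘ (trans e f)

  +-cong-≡ₘ : ∀ {x x′ y y′} → x ≡ₘ x′ → y ≡ₘ y′ → x + y ≡ₘ x′ + y′
  +-cong-≡ₘ {x} {x′} {y} {y′} (mk≡ₘ e) (mk≡ₘ f) = mk≡ₘ (begin
    (x + y) % m                ≡⟨ %-distribˡ-+ x y m ⟩
    (x % m + y % m) % m        ≡⟨ cong₂ (λ s t → (s + t) % m) e f ⟩
    (x′ % m + y′ % m) % m      ≡⟨ %-distribˡ-+ x′ y′ m ⟨
    (x′ + y′) % m              ∎)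
    where open ≡-Reasoning

  *-cong-≡ₘ : ∀ {x x′ y y′} → x ≡ₘ x′ → y ≡ₘ y′ → x * y ≡ₘ x′ * y′
  *-cong-≡ₘ {x} {x′} {y} {y′} (mk≡ₘ e) (mk≡ₘ f) = mk≡ₘ (begin
    (x * y) % m                ≡⟨ %-distribˡ-* x y m ⟩
    (x % m * (y % m)) % m      ≡⟨ cong₂ (λ s t → (s * t) % m) e f ⟩
    (x′ % m * (y′ % m)) % m    ≡⟨ %-distribˡ-* x′ y′ m ⟨
    (x′ * y′) % m              ∎)
    where open ≡-Reasoning

  ≡ₘ-setoid : Setoid 0ℓ 0ℓ
  ≡ₘ-setoid = record { Carrier = ℕ ; _≈_ = _≡ₘ_
                     ; isEquivalence = record { refl = ≡ₘ-refl ; sym = ≡ₘ-sym ; trans = ≡ₘ-trans } }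

  module ≡ₘ-Reasoning = SetoidReasoning ≡ₘ-setoid

  *m≡ₘ0 : ∀ x → x * m ≡ₘ 0
  *m≡ₘ0 x = mk≡ₘ (trans (m*n%n≡0 x m) (sym (m<n⇒m%n≡m (>-nonZero⁻¹ m))))

  m≡ₘ0 : m ≡ₘ 0
  m≡ₘ0 = ≡ₘ-trans (≡ₘ-reflexive (sym (*-identityˡ m))) (*m≡ₘ0 1)

  ≡ₘ0⇒∣ : ∀ {x} → x ≡ₘ 0 → m ∣ x
  ≡ₘ0⇒∣ (mk≡ₘ e) = m%n≡0⇒n∣m _ m (trans e (m<n⇒m%n≡m (>-nonZero⁻¹ m)))

  ∣⇒≡ₘ0 : ∀ {x} → m ∣ x → x ≡ₘ 0
  ∣⇒≡ₘ0 (divides q refl) = *m≡ₘ0 q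

  <-≡ₘ⇒≡ : ∀ {x y} → x < m → y < m → x ≡ₘ y → x ≡ y
  <-≡ₘ⇒≡ x<m y<m (mk≡ₘ e) = trans (sym (m<n⇒m%n≡m x<m)) (trans e (m<n⇒m%n≡m y<m))

  toℕ-mod : ∀ x → toℕ (x mod m) ≡ₘ x
  toℕ-mod x = mk≡ₘ (trans (cong (_% m) (toℕ-fromℕ< (m%n<n x m))) (m%n%n≡m%n x m))

  toℕ-injectiveₘ : ∀ {s t : Fin m} → toℕ s ≡ₘ toℕ t → s ≡ t
  toℕ-injectiveₘ {s} {t} s≡t = toℕ-injective (<-≡ₘ⇒≡ (toℕ<n s) (toℕ<n t) s≡t)

  mod-cong : ∀ {x y} → x ≡ₘ y → x mod m ≡ y mod m
  mod-cong x≡y = toℕ-injectiveₘ (≡ₘ-trans (toℕ-mod _) (≡ₘ-trans x≡y (≡ₘ-sym (toℕ-mod _))))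

  mod-toℕ : ∀ {x} {t : Fin m} → x ≡ₘ toℕ t → x mod m ≡ t
  mod-toℕ x≡t = toℕ-injectiveₘ (≡ₘ-trans (toℕ-mod _) x≡t)

module PrimeField (p : ℕ) (pp : Prime p) where

  instance
    p≢0 : NonZero p
    p≢0 = prime⇒nonZero pp

  open Modular p

  infixl 6 _⊕_
  infixl 7 _⊗_
  infix 8 ⊖_

  _⊕_ _⊗_ : F p → F p → F p
  _⊕_ = _+F_ p
  _⊗_ = _*F_ p

  𝟘 𝟙 : F p
  𝟘 = 0F p
  𝟙 = 1 mod p

  ⊖_ : F p → F p
  ⊖ a = (p ∸ toℕ a) mod p

  ⊕-≡ₘ : ∀ a b {x y} → toℕ a ≡ₘ x → toℕ b ≡ₘ y → toℕ (a ⊕ b) ≡ₘ x + y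
  ⊕-≡ₘ _ _ a≡x b≡y = ≡ₘ-trans (toℕ-mod _) (+-cong-≡ₘ a≡x b≡y)

  ⊗-≡ₘ : ∀ a b {x y} → toℕ a ≡ₘ x → toℕ b ≡ₘ y → toℕ (a ⊗ b) ≡ₘ x * y
  ⊗-≡ₘ _ _ a≡x b≡y = ≡ₘ-trans (toℕ-mod _) (*-cong-≡ₘ a≡x b≡y)

  -- Every ring law of F p is a law of ℕ read modulo p.
  ≡-via-ℕ : ∀ {a b x y} → toℕ a ≡ₘ x → toℕ b ≡ₘ y → x ≡ₘ y → a ≡ b
  ≡-via-ℕ a≡x b≡y x≡y = toℕ-injectiveₘ (≡ₘ-trans a≡x (≡ₘ-trans x≡y (≡ₘ-sym b≡y)))

  private
    r : ∀ {x} → x ≡ₘ x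
    r = ≡ₘ-refl

  ⊕-comm : ∀ a b → a ⊕ b ≡ b ⊕ a
  ⊕-comm a b = ≡-via-ℕ (⊕-≡ₘ a b r r) (⊕-≡ₘ b a r r) (≡ₘ-reflexive (+-comm (toℕ a) (toℕ b)))

  ⊕-assoc : ∀ a b c → (a ⊕ b) ⊕ c ≡ a ⊕ (b ⊕ c)
  ⊕-assoc a b c = ≡-via-ℕ (⊕-≡ₘ (a ⊕ b) c (⊕-≡ₘ a b r r) r) (⊕-≡ₘ a (b ⊕ c) r (⊕-≡ₘ b c r r)) (≡ₘ-reflexive (+-assoc (toℕ a) (toℕ b) (toℕ c)))

  ⊕-identityˡ : ∀ a → 𝟘 ⊕ a ≡ a
  ⊕-identityˡ a = ≡-via-ℕ (⊕-≡ₘ 𝟘 a (toℕ-mod 0) r) r r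

  ⊕-identityʳ : ∀ a → a ⊕ 𝟘 ≡ a
  ⊕-identityʳ a = trans (⊕-comm a 𝟘) (⊕-identityˡ a)

  ⊖-inverseˡ : ∀ a → ⊖ a ⊕ a ≡ 𝟘
  ⊖-inverseˡ a = ≡-via-ℕ (⊕-≡ₘ (⊖ a) a (toℕ-mod _) r) (toℕ-mod 0)
    (≡ₘ-trans (≡ₘ-reflexive (m∸n+n≡m (<⇒≤ (toℕ<n a)))) m≡ₘ0)

  ⊖-inverseʳ : ∀ a → a ⊕ ⊖ a ≡ 𝟘
  ⊖-inverseʳ a = trans (⊕-comm a (⊖ a)) (⊖-inverseˡ a)

  ⊗-comm : ∀ a b → a ⊗ b ≡ b ⊗ a
  ⊗-comm a b = ≡-via-ℕ (⊗-≡ₘ a b r r) (⊗-≡ₘ b a r r) (≡ₘ-reflexive (*-comm (toℕ a) (toℕ b)))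

  ⊗-assoc : ∀ a b c → (a ⊗ b) ⊗ c ≡ a ⊗ (b ⊗ c)
  ⊗-assoc a b c = ≡-via-ℕ (⊗-≡ₘ (a ⊗ b) c (⊗-≡ₘ a b r r) r) (⊗-≡ₘ a (b ⊗ c) r (⊗-≡ₘ b c r r)) (≡ₘ-reflexive (*-assoc (toℕ a) (toℕ b) (toℕ c)))

  ⊗-identityˡ : ∀ a → 𝟙 ⊗ a ≡ a
  ⊗-identityˡ a = ≡-via-ℕ (⊗-≡ₘ 𝟙 a (toℕ-mod 1) r) r (≡ₘ-reflexive (*-identityˡ (toℕ a)))

  ⊗-identityʳ : ∀ a → a ⊗ 𝟙 ≡ a
  ⊗-identityʳ a = trans (⊗-comm a 𝟙) (⊗-identityˡ a)

  ⊗-distribˡ-⊕ : ∀ a b c → a ⊗ (b ⊕ c) ≡ a ⊗ b ⊕ a ⊗ c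
  ⊗-distribˡ-⊕ a b c = ≡-via-ℕ (⊗-≡ₘ a (b ⊕ c) r (⊕-≡ₘ b c r r)) (⊕-≡ₘ (a ⊗ b) (a ⊗ c) (⊗-≡ₘ a b r r) (⊗-≡ₘ a c r r))
    (≡ₘ-reflexive (*-distribˡ-+ (toℕ a) (toℕ b) (toℕ c)))

  ⊗-distribʳ-⊕ : ∀ a b c → (b ⊕ c) ⊗ a ≡ b ⊗ a ⊕ c ⊗ a
  ⊗-distribʳ-⊕ a b c = trans (⊗-comm (b ⊕ c) a)
    (trans (⊗-distribˡ-⊕ a b c) (cong₂ _⊕_ (⊗-comm a b) (⊗-comm a c)))

  ⊕-⊗-isCommutativeRing : IsCommutativeRing _≡_ _⊕_ _⊗_ ⊖_ 𝟘 𝟙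
  ⊕-⊗-isCommutativeRing = record
    { isRing = record
      { +-isAbelianGroup = record
        { isGroup = record
          { isMonoid = record
            { isSemigroup = record
              { isMagma = record { isEquivalence = isEquivalence ; ∙-cong = cong₂ _⊕_ }
              ; assoc = ⊕-assoc }
            ; identity = ⊕-identityˡ , ⊕-identityʳ }
          ; inverse = ⊖-inverseˡ , ⊖-inverseʳ
          ; ⁻¹-cong = cong ⊖_ }
        ; comm = ⊕-comm }
      ; *-cong = cong₂ _⊗_
      ; *-assoc = ⊗-assoc
      ; *-identity = ⊗-identityˡ , ⊗-identityʳ
      ; distrib = ⊗-distribˡ-⊕ , ⊗-distribʳ-⊕ }
    ; *-comm = ⊗-comm }

  commutativeRing : CommutativeRing 0ℓ 0ℓ
  commutativeRing = record { isCommutativeRing = ⊕-⊗-isCommutativeRing }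

  open IsCommutativeRing ⊕-⊗-isCommutativeRing public using (zeroˡ; zeroʳ)

  open import Algebra.Properties.Group (CommutativeRing.+-group commutativeRing) public
    using (x∙y⁻¹≈ε⇒x≈y; ε⁻¹≈ε; inverseˡ-unique; ⁻¹-involutive)
  open import Algebra.Properties.AbelianGroup (CommutativeRing.+-abelianGroup commutativeRing) public
    using (⁻¹-∙-comm)
  open import Algebra.Properties.CommutativeSemigroup (CommutativeRing.+-commutativeSemigroup commutativeRing) public
    using (interchange; x∙yz≈y∙xz)
  open import Algebra.Properties.Ring (CommutativeRing.ring commutativeRing) public
    using (-‿distribˡ-*; -‿distribʳ-*; -1*x≈-x)

  𝟙≢𝟘 : 𝟙 ≢ 𝟘
  𝟙≢𝟘 𝟙≡𝟘 with <-≡ₘ⇒≡ (nonTrivial⇒n>1 p {{prime⇒nonTrivial pp}}) (>-nonZero⁻¹ p)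
                      (≡ₘ-trans (≡ₘ-sym (toℕ-mod 1)) (≡ₘ-trans (≡ₘ-reflexive (cong toℕ 𝟙≡𝟘)) (toℕ-mod 0)))
  ... | ()

  ⊗-inverse : ∀ a → a ≢ 𝟘 → Σ (F p) λ u → u ⊗ a ≡ 𝟙
  ⊗-inverse a a≢𝟘 with coprime-Bézout (prime⇒coprime pp {{≢-nonZero toℕa≢0}} (toℕ<n a))
    where
    toℕa≢0 : toℕ a ≢ 0
    toℕa≢0 e = a≢𝟘 (toℕ-injectiveₘ (≡ₘ-trans (≡ₘ-reflexive e) (≡ₘ-sym (toℕ-mod 0))))
  ... | Bézout.+- x y 1+ya≡xp = ⊖ (y mod p) ,
          sym (trans (inverseˡ-unique 𝟙 (y mod p ⊗ a) 𝟙⊕ya≡𝟘) (-‿distribˡ-* (y mod p) a))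
    where
    𝟙⊕ya≡𝟘 : 𝟙 ⊕ y mod p ⊗ a ≡ 𝟘
    𝟙⊕ya≡𝟘 = ≡-via-ℕ (⊕-≡ₘ 𝟙 (y mod p ⊗ a) (toℕ-mod 1) (⊗-≡ₘ (y mod p) a (toℕ-mod y) r)) (toℕ-mod 0)
      (≡ₘ-trans (≡ₘ-reflexive 1+ya≡xp) (*m≡ₘ0 x))
  ... | Bézout.-+ x y ya≡1+xp = y mod p , ≡-via-ℕ (⊗-≡ₘ (y mod p) a (toℕ-mod y) r) (toℕ-mod 1)
          (≡ₘ-trans (≡ₘ-reflexive (sym ya≡1+xp)) (mk≡ₘ ([m+kn]%n≡m%n 1 x p)))

  ⊖𝟙≢𝟘 : ⊖ 𝟙 ≢ 𝟘
  ⊖𝟙≢𝟘 ⊖𝟙≡𝟘 = 𝟙≢𝟘 (trans (sym (⁻¹-involutive 𝟙)) (trans (cong ⊖_ ⊖𝟙≡𝟘) ε⁻¹≈ε))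

  ⊖𝟙⊗x⊕x≡𝟘 : ∀ x → ⊖ 𝟙 ⊗ x ⊕ x ≡ 𝟘
  ⊖𝟙⊗x⊕x≡𝟘 x = trans (cong (_⊕ x) (-1*x≈-x x)) (⊖-inverseˡ x)

  s⊗a⊕⊖s⊗a≡𝟘 : ∀ s a → s ⊗ a ⊕ ⊖ s ⊗ a ≡ 𝟘
  s⊗a⊕⊖s⊗a≡𝟘 s a = trans (sym (⊗-distribʳ-⊕ a s (⊖ s))) (trans (cong (_⊗ a) (⊖-inverseʳ s)) (zeroˡ a))

  a⊕[b⊕⊖a]≡b : ∀ a b → a ⊕ (b ⊕ ⊖ a) ≡ b
  a⊕[b⊕⊖a]≡b a b = trans (x∙yz≈y∙xz a b (⊖ a)) (trans (cong (b ⊕_) (⊖-inverseʳ a)) (⊕-identityʳ b))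

  x≡s⊗a⊕[x⊕⊖s⊗a] : ∀ x s a → x ≡ s ⊗ a ⊕ (x ⊕ ⊖ s ⊗ a)
  x≡s⊗a⊕[x⊕⊖s⊗a] x s a = begin
    x                        ≡⟨ ⊕-identityʳ x ⟨
    x ⊕ 𝟘                    ≡⟨ cong (x ⊕_) (s⊗a⊕⊖s⊗a≡𝟘 s a) ⟨
    x ⊕ (s ⊗ a ⊕ ⊖ s ⊗ a)    ≡⟨ x∙yz≈y∙xz x (s ⊗ a) (⊖ s ⊗ a) ⟩
    s ⊗ a ⊕ (x ⊕ ⊖ s ⊗ a)    ∎
    where open ≡-Reasoning

module LinearAlgebra (p : ℕ) (pp : Prime p) where

  open PrimeField p pp

  infix 4 _≈ᵛ_
  infixl 6 _+ᵛ_
  infixr 7 _·ᵛ_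

  V : ℕ → Set
  V = Vec p

  _≈ᵛ_ : ∀ {n} → V n → V n → Set
  _≈ᵛ_ = _≈_ p

  _+ᵛ_ : ∀ {n} → V n → V n → V n
  _+ᵛ_ = _+V_ p

  _·ᵛ_ : ∀ {n} → F p → V n → V n
  _·ᵛ_ = _·V_ p

  0ᵛ : ∀ {n} → V n
  0ᵛ = 0V p

  -ᵛ_ : ∀ {n} → V n → V n
  (-ᵛ x) i = ⊖ x i

  record IsLinear {n m} (f : V n → V m) : Set where
    field
      ≈-cong : ∀ {x y} → x ≈ᵛ y → f x ≈ᵛ f y
      +-homo : ∀ x y → f (x +ᵛ y) ≈ᵛ f x +ᵛ f y
      ·-homo : ∀ a x → f (a ·ᵛ x) ≈ᵛ a ·ᵛ f x

    0-homo : f 0ᵛ ≈ᵛ 0ᵛ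
    0-homo j = begin
      f 0ᵛ j          ≡⟨ ≈-cong (λ _ → sym (zeroˡ 𝟘)) j ⟩
      f (𝟘 ·ᵛ 0ᵛ) j   ≡⟨ ·-homo 𝟘 0ᵛ j ⟩
      𝟘 ⊗ f 0ᵛ j      ≡⟨ zeroˡ _ ⟩
      𝟘               ∎
      where open ≡-Reasoning

  open IsLinear public

  ∘-isLinear : ∀ {n m l} {f : V n → V m} {g : V m → V l} → IsLinear f → IsLinear g → IsLinear (g ∘ f)
  ∘-isLinear {f = f} {g} f-lin g-lin = record
    { ≈-cong = λ x≈y → ≈-cong g-lin (≈-cong f-lin x≈y)
    ; +-homo = λ x y j → trans (≈-cong g-lin (+-homo f-lin x y) j) (+-homo g-lin (f x) (f y) j)
    ; ·-homo = λ a x j → trans (≈-cong g-lin (·-homo f-lin a x) j) (·-homo g-lin a (f x) j)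
    }

  lincomb-homo : ∀ {n m} {f : V n → V m} → IsLinear f →
                 ∀ d c v → f (lincomb p d c v) ≈ᵛ lincomb p d c (f ∘ v)
  lincomb-homo f-lin zero    c v = 0-homo f-lin
  lincomb-homo f-lin (suc d) c v j = trans (+-homo f-lin _ _ j)
    (cong₂ _⊕_ (·-homo f-lin (c zero) (v zero) j) (lincomb-homo f-lin d (c ∘ suc) (v ∘ suc) j))

  lincomb-zero : ∀ {n} d c (v : Fin d → V n) → (∀ j → v j ≈ᵛ 0ᵛ) → lincomb p d c v ≈ᵛ 0ᵛ
  lincomb-zero zero    c v v≈0 i = refl
  lincomb-zero (suc d) c v v≈0 i =
    trans (cong₂ _⊕_ (trans (cong (c zero ⊗_) (v≈0 zero i)) (zeroʳ (c zero)))
                     (lincomb-zero d (c ∘ suc) (v ∘ suc) (v≈0 ∘ suc) i))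
          (⊕-identityˡ 𝟘)

  Independent : ∀ {n} d → (Fin d → V n) → Set
  Independent d v = ∀ c → lincomb p d c v ≈ᵛ 0ᵛ → ∀ j → c j ≡ 𝟘

  tail-independent : ∀ {n d} (v : Fin (suc d) → V n) → Independent (suc d) v → Independent d (v ∘ suc)
  tail-independent {d = d} v ind c c·v≈0 j = ind (𝟘 ∷ c) 𝟘∷c·v≈0 (suc j)
    where
    𝟘∷c·v≈0 : lincomb p (suc d) (𝟘 ∷ c) v ≈ᵛ 0ᵛ
    𝟘∷c·v≈0 i = trans (cong₂ _⊕_ (zeroˡ (v zero i)) (c·v≈0 i)) (⊕-identityˡ 𝟘)

  head∉span-tail : ∀ {n d} (v : Fin (suc d) → V n) → Independent (suc d) v →
                   ¬ Σ (Fin d → F p) (λ c → v zero ≈ᵛ lincomb p d c (v ∘ suc))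
  head∉span-tail {d = d} v ind (c , v₀≈c·v) = ⊖𝟙≢𝟘 (ind (⊖ 𝟙 ∷ c) ⊖𝟙∷c·v≈0 zero)
    where
    ⊖𝟙∷c·v≈0 : lincomb p (suc d) (⊖ 𝟙 ∷ c) v ≈ᵛ 0ᵛ
    ⊖𝟙∷c·v≈0 i = trans (cong (λ t → ⊖ 𝟙 ⊗ t ⊕ lincomb p d c (v ∘ suc) i) (v₀≈c·v i))
                       (⊖𝟙⊗x⊕x≡𝟘 (lincomb p d c (v ∘ suc) i))

  nonzero-coordinate : ∀ {n} (x : V n) → ¬ x ≈ᵛ 0ᵛ → Σ (Fin n) λ i → x i ≢ 𝟘
  nonzero-coordinate x x≉0 with any? (λ i → ¬? (x i ≟ 𝟘))
  ... | yes found = found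
  ... | no none   = ⊥-elim (x≉0 λ i → decidable-stable (x i ≟ 𝟘) λ xᵢ≢0 → none (i , xᵢ≢0))

  record LineQuotient {k} (w : V (suc k)) : Set where
    field
      map         : V (suc k) → V k
      linear      : IsLinear map
      kills       : map w ≈ᵛ 0ᵛ
      surjective  : ∀ z → Σ (V (suc k)) λ y → map y ≈ᵛ z
      kernel⊆line : ∀ y → map y ≈ᵛ 0ᵛ → Σ (F p) λ s → y ≈ᵛ s ·ᵛ w

  -- Subtract from y the multiple of w with the same i-th coordinate, then delete that coordinate.
  lineQuotient : ∀ {k} (w : V (suc k)) (i : Fin (suc k)) → w i ≢ 𝟘 → LineQuotient w
  lineQuotient {k} w i wᵢ≢0 = record
    { map = ψ ; linear = ψ-linear ; kills = ψw≈0 ; surjective = ψ-surjective ; kernel⊆line = ψ-kernel }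
    where
    u : F p
    u = proj₁ (⊗-inverse (w i) wᵢ≢0)

    uwᵢ≡𝟙 : u ⊗ w i ≡ 𝟙
    uwᵢ≡𝟙 = proj₂ (⊗-inverse (w i) wᵢ≢0)

    ψ : V (suc k) → V _
    ψ y = removeAt (λ j → y j ⊕ ⊖ (y i ⊗ u ⊗ w j)) i

    +-homo-pointwise : ∀ a a′ b b′ c → (a ⊕ a′) ⊕ ⊖ ((b ⊕ b′) ⊗ u ⊗ c) ≡ (a ⊕ ⊖ (b ⊗ u ⊗ c)) ⊕ (a′ ⊕ ⊖ (b′ ⊗ u ⊗ c))
    +-homo-pointwise a a′ b b′ c = begin
      (a ⊕ a′) ⊕ ⊖ ((b ⊕ b′) ⊗ u ⊗ c)                ≡⟨ cong (λ t → (a ⊕ a′) ⊕ ⊖ t) (trans (cong (_⊗ c) (⊗-distribʳ-⊕ u b b′)) (⊗-distribʳ-⊕ c (b ⊗ u) (b′ ⊗ u))) ⟩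
      (a ⊕ a′) ⊕ ⊖ (b ⊗ u ⊗ c ⊕ b′ ⊗ u ⊗ c)          ≡⟨ cong ((a ⊕ a′) ⊕_) (⁻¹-∙-comm (b ⊗ u ⊗ c) (b′ ⊗ u ⊗ c)) ⟨
      (a ⊕ a′) ⊕ (⊖ (b ⊗ u ⊗ c) ⊕ ⊖ (b′ ⊗ u ⊗ c))    ≡⟨ interchange a a′ (⊖ (b ⊗ u ⊗ c)) (⊖ (b′ ⊗ u ⊗ c)) ⟩
      (a ⊕ ⊖ (b ⊗ u ⊗ c)) ⊕ (a′ ⊕ ⊖ (b′ ⊗ u ⊗ c))    ∎
      where open ≡-Reasoning

    ·-homo-pointwise : ∀ a x b c → a ⊗ x ⊕ ⊖ (a ⊗ b ⊗ u ⊗ c) ≡ a ⊗ (x ⊕ ⊖ (b ⊗ u ⊗ c))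
    ·-homo-pointwise a x b c = begin
      a ⊗ x ⊕ ⊖ (a ⊗ b ⊗ u ⊗ c)    ≡⟨ cong (λ t → a ⊗ x ⊕ ⊖ t) (trans (⊗-assoc (a ⊗ b) u c) (⊗-assoc a b (u ⊗ c))) ⟩
      a ⊗ x ⊕ ⊖ (a ⊗ (b ⊗ (u ⊗ c))) ≡⟨ cong (λ t → a ⊗ x ⊕ ⊖ (a ⊗ t)) (⊗-assoc b u c) ⟨
      a ⊗ x ⊕ ⊖ (a ⊗ (b ⊗ u ⊗ c))  ≡⟨ cong (a ⊗ x ⊕_) (-‿distribʳ-* a (b ⊗ u ⊗ c)) ⟩
      a ⊗ x ⊕ a ⊗ ⊖ (b ⊗ u ⊗ c)    ≡⟨ ⊗-distribˡ-⊕ a x (⊖ (b ⊗ u ⊗ c)) ⟨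
      a ⊗ (x ⊕ ⊖ (b ⊗ u ⊗ c))      ∎
      where open ≡-Reasoning

    ψ-linear : IsLinear ψ
    ψ-linear = record
      { ≈-cong = λ x≈y j → cong₂ (λ s t → s ⊕ ⊖ (t ⊗ u ⊗ w (punchIn i j))) (x≈y _) (x≈y i)
      ; +-homo = λ x y j → +-homo-pointwise _ _ (x i) (y i) _
      ; ·-homo = λ a x j → ·-homo-pointwise a _ (x i) _
      }

    ψw≈0 : ψ w ≈ᵛ 0ᵛ
    ψw≈0 j = begin
      wⱼ ⊕ ⊖ (w i ⊗ u ⊗ wⱼ)  ≡⟨ cong (λ t → wⱼ ⊕ ⊖ (t ⊗ wⱼ)) (trans (⊗-comm (w i) u) uwᵢ≡𝟙) ⟩
      wⱼ ⊕ ⊖ (𝟙 ⊗ wⱼ)        ≡⟨ cong (λ t → wⱼ ⊕ ⊖ t) (⊗-identityˡ wⱼ) ⟩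
      wⱼ ⊕ ⊖ wⱼ              ≡⟨ ⊖-inverseʳ wⱼ ⟩
      𝟘                      ∎
      where
      open ≡-Reasoning
      wⱼ = w (punchIn i j)

    ψ-surjective : ∀ z → Σ (V (suc k)) λ y → ψ y ≈ᵛ z
    ψ-surjective z = insertAt z i 𝟘 , ψy≈z
      where
      y = insertAt z i 𝟘
      ψy≈z : ψ y ≈ᵛ z
      ψy≈z j = begin
        y (punchIn i j) ⊕ ⊖ (y i ⊗ u ⊗ wⱼ)  ≡⟨ cong₂ (λ s t → s ⊕ ⊖ (t ⊗ u ⊗ wⱼ)) (insertAt-punchIn z i 𝟘 j) (insertAt-lookup z i 𝟘) ⟩
        z j ⊕ ⊖ (𝟘 ⊗ u ⊗ wⱼ)                ≡⟨ cong (λ t → z j ⊕ ⊖ t) (trans (cong (_⊗ wⱼ) (zeroˡ u)) (zeroˡ wⱼ)) ⟩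
        z j ⊕ ⊖ 𝟘                            ≡⟨ cong (z j ⊕_) ε⁻¹≈ε ⟩
        z j ⊕ 𝟘                              ≡⟨ ⊕-identityʳ (z j) ⟩
        z j                                  ∎
        where
        open ≡-Reasoning
        wⱼ = w (punchIn i j)

    ψ-kernel : ∀ y → ψ y ≈ᵛ 0ᵛ → Σ (F p) λ s → y ≈ᵛ s ·ᵛ w
    ψ-kernel y ψy≈0 = y i ⊗ u , yⱼ≡yᵢuwⱼ
      where
      yⱼ≡yᵢuwⱼ : ∀ j → y j ≡ y i ⊗ u ⊗ w j
      yⱼ≡yᵢuwⱼ j with i ≟ j
      ... | yes refl = sym (trans (⊗-assoc (y i) u (w i)) (trans (cong (y i ⊗_) uwᵢ≡𝟙) (⊗-identityʳ (y i))))
      ... | no i≢j   = subst (λ t → y t ≡ y i ⊗ u ⊗ w t) (punchIn-punchOut i≢j)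
                             (x∙y⁻¹≈ε⇒x≈y _ _ (ψy≈0 (punchOut i≢j)))

  record QuotientMap {n} d (v : Fin d → V n) k : Set where
    field
      map         : V n → V k
      linear      : IsLinear map
      kills       : ∀ j → map (v j) ≈ᵛ 0ᵛ
      surjective  : ∀ z → Σ (V n) λ x → map x ≈ᵛ z
      kernel⊆span : ∀ x → map x ≈ᵛ 0ᵛ → Σ (Fin d → F p) λ c → x ≈ᵛ lincomb p d c v

    kills-span : ∀ c → map (lincomb p d c v) ≈ᵛ 0ᵛ
    kills-span c j = trans (lincomb-homo linear d c v j) (lincomb-zero d c (map ∘ v) kills j)

  identity-quotientMap : ∀ {n} (v : Fin 0 → V n) → QuotientMap 0 v n
  identity-quotientMap v = record
    { map = λ x → x
    ; linear = record { ≈-cong = λ x≈y → x≈y ; +-homo = λ _ _ _ → refl ; ·-homo = λ _ _ _ → refl }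
    ; kills = λ ()
    ; surjective = λ z → z , λ _ → refl
    ; kernel⊆span = λ x x≈0 → (λ ()) , x≈0
    }

  quotientMap-suc : ∀ {n d k} (v : Fin (suc d) → V n) (E : QuotientMap d (v ∘ suc) (suc k)) →
                    LineQuotient (QuotientMap.map E (v zero)) → QuotientMap (suc d) v k
  quotientMap-suc {d = d} v E L = record
    { map = L.map ∘ E.map
    ; linear = ∘-isLinear E.linear L.linear
    ; kills = kills
    ; surjective = surjective
    ; kernel⊆span = kernel⊆span
    }
    where
    module E = QuotientMap E
    module L = LineQuotient L

    kills : ∀ j → L.map (E.map (v j)) ≈ᵛ 0ᵛ
    kills zero    = L.kills
    kills (suc j) i = trans (≈-cong L.linear (E.kills j) i) (0-homo L.linear i)

    surjective : ∀ z → Σ (V _) λ x → L.map (E.map x) ≈ᵛ z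
    surjective z = proj₁ (E.surjective y) , λ j → trans (≈-cong L.linear (proj₂ (E.surjective y)) j) (proj₂ (L.surjective z) j)
      where y = proj₁ (L.surjective z)

    kernel⊆span : ∀ x → L.map (E.map x) ≈ᵛ 0ᵛ → Σ (Fin (suc d) → F p) λ c → x ≈ᵛ lincomb p (suc d) c v
    kernel⊆span x ψφx≈0 = s ∷ c , λ j → trans (x≡s⊗a⊕[x⊕⊖s⊗a] (x j) s (v zero j)) (cong (s ⊗ v zero j ⊕_) (x′≈c·v j))
      where
      s = proj₁ (L.kernel⊆line (E.map x) ψφx≈0)
      x′ = x +ᵛ ⊖ s ·ᵛ v zero
      φx′≈0 : E.map x′ ≈ᵛ 0ᵛ
      φx′≈0 j = trans (+-homo E.linear x _ j)
        (trans (cong₂ _⊕_ (proj₂ (L.kernel⊆line (E.map x) ψφx≈0) j) (·-homo E.linear (⊖ s) (v zero) j))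
               (s⊗a⊕⊖s⊗a≡𝟘 s _))
      c = proj₁ (E.kernel⊆span x′ φx′≈0)
      x′≈c·v = proj₂ (E.kernel⊆span x′ φx′≈0)

  -- Quotient by v ∘ suc first; the image of v zero is then nonzero by independence.
  quotientMap : ∀ d k {n} → d + k ≡ n → (v : Fin d → V n) → Independent d v → QuotientMap d v k
  quotientMap zero    k refl v _   = identity-quotientMap v
  quotientMap (suc d) k d+k≡n v ind = quotientMap-suc v E (lineQuotient w (proj₁ nonzero) (proj₂ nonzero))
    where
    E = quotientMap d (suc k) (trans (+-suc d k) d+k≡n) (v ∘ suc) (tail-independent v ind)
    w = QuotientMap.map E (v zero)
    nonzero = nonzero-coordinate w λ w≈0 → head∉span-tail v ind (QuotientMap.kernel⊆span E (v zero) w≈0)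

module Rotation (b′ : ℕ) where

  open Modular (suc b′)

  b : ℕ
  b = suc b′

  rot : ∀ {A : Set} → ℕ → (Fin b → A) → Fin b → A
  rot m x i = x ((toℕ i + m) mod b)

  rot-≡ₘ : ∀ {A : Set} {m m′} (x : Fin b → A) → m ≡ₘ m′ → ∀ i → rot m x i ≡ rot m′ x i
  rot-≡ₘ x m≡m′ i = cong x (mod-cong (+-cong-≡ₘ (≡ₘ-refl {toℕ i}) m≡m′))

  rot-rot : ∀ {A : Set} m m′ (x : Fin b → A) i → rot m (rot m′ x) i ≡ rot (m + m′) x i
  rot-rot m m′ x i = cong x (mod-cong (≡ₘ-trans (+-cong-≡ₘ (toℕ-mod (toℕ i + m)) ≡ₘ-refl)
                                                (≡ₘ-reflexive (+-assoc (toℕ i) m m′))))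

  rot-id : ∀ {A : Set} {m} (x : Fin b → A) → m ≡ₘ 0 → ∀ i → rot m x i ≡ x i
  rot-id x m≡0 i = cong x (mod-toℕ (≡ₘ-trans (+-cong-≡ₘ ≡ₘ-refl m≡0) (≡ₘ-reflexive (+-identityʳ (toℕ i)))))

  m+m*b′≡ₘ0 : ∀ m → m + m * b′ ≡ₘ 0
  m+m*b′≡ₘ0 m = ≡ₘ-trans (≡ₘ-reflexive (sym (*-suc m b′))) (*m≡ₘ0 m)

  rot-rot-inverse : ∀ {A : Set} m (x : Fin b → A) i → rot m (rot (m * b′) x) i ≡ x i
  rot-rot-inverse m x i = trans (rot-rot m (m * b′) x i) (rot-id x (m+m*b′≡ₘ0 m) i)

  toℕ-predC : ∀ (i : Fin b) → toℕ (predC i) ≡ₘ toℕ i + b′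
  toℕ-predC zero    = ≡ₘ-reflexive (toℕ-fromℕ b′)
  toℕ-predC (suc i) = ≡ₘ-trans (≡ₘ-reflexive (trans (toℕ-inject₁ i) (sym (+-identityʳ (toℕ i)))))
                        (≡ₘ-trans (+-cong-≡ₘ (≡ₘ-refl {toℕ i}) (≡ₘ-sym m≡ₘ0))
                                  (≡ₘ-reflexive (+-suc (toℕ i) b′)))

  σ^-rot : ∀ {A : Set} s (x : Fin b → A) i → σ^ s x i ≡ rot (s * b′) x i
  σ^-rot zero    x i = sym (rot-id x ≡ₘ-refl i)
  σ^-rot (suc s) x i = trans (σ^-rot s x (predC i)) (cong x (mod-cong
    (≡ₘ-trans (+-cong-≡ₘ (toℕ-predC i) ≡ₘ-refl) (≡ₘ-reflexive (+-assoc (toℕ i) b′ (s * b′))))))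

module AffineAction (p : ℕ) (pp : Prime p) (b′ k : ℕ)
                    (φ : LinearAlgebra.V p pp (suc b′) → LinearAlgebra.V p pp k)
                    (φ-linear : LinearAlgebra.IsLinear p pp φ) where

  open PrimeField p pp
  open LinearAlgebra p pp
  open Rotation b′
  open Modular b

  Point : Set
  Point = V k × Fin b

  infix 4 _≈ₚ_
  _≈ₚ_ : Point → Point → Set
  (w , t) ≈ₚ (w′ , t′) = w ≈ᵛ w′ × t ≡ t′

  ≈ₚ-trans : ∀ {x y z} → x ≈ₚ y → y ≈ₚ z → x ≈ₚ z
  ≈ₚ-trans (w≈w′ , t≡t′) (w′≈w″ , t′≡t″) = (λ j → trans (w≈w′ j) (w′≈w″ j)) , trans t≡t′ t′≡t″

  -- The semidirect product ℤ_b ⋉ F_p^b, acting on F_p^k × ℤ_b through φ.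
  Element : Set
  Element = ℕ × V b

  act : Element → Point → Point
  act (r , v) (w , t) = w +ᵛ φ (rot (toℕ t) v) , (toℕ t + r) mod b

  infixl 7 _∙_
  infix 8 _⁻¹

  _∙_ : Element → Element → Element
  (r , v) ∙ (r′ , v′) = r′ + r , v′ +ᵛ rot r′ v

  -- r * b′ ≡ -r (mod b)
  _⁻¹ : Element → Element
  (r , v) ⁻¹ = r * b′ , -ᵛ rot (r * b′) v

  ε : Element
  ε = 0 , 0ᵛ

  act-cong : ∀ g {x y} → x ≈ₚ y → act g x ≈ₚ act g y
  act-cong (r , v) {_ , t} (w≈w′ , refl) = (λ j → cong (_⊕ φ (rot (toℕ t) v) j) (w≈w′ j)) , refl

  act-∙ : ∀ g h x → act g (act h x) ≈ₚ act (g ∙ h) x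
  act-∙ (r , v) (r′ , v′) (w , t) = w-part , t-part
    where
    t′ = (toℕ t + r′) mod b

    φ-rot-t′ : φ (rot (toℕ t′) v) ≈ᵛ φ (rot (toℕ t) (rot r′ v))
    φ-rot-t′ = ≈-cong φ-linear λ i → trans (rot-≡ₘ v (toℕ-mod (toℕ t + r′)) i) (sym (rot-rot (toℕ t) r′ v i))

    w-part : ∀ j → (w j ⊕ φ (rot (toℕ t) v′) j) ⊕ φ (rot (toℕ t′) v) j ≡ w j ⊕ φ (rot (toℕ t) (v′ +ᵛ rot r′ v)) j
    w-part j = trans (⊕-assoc (w j) _ _) (cong (w j ⊕_) (sym (trans (+-homo φ-linear (rot (toℕ t) v′) (rot (toℕ t) (rot r′ v)) j)
                                                                     (cong (φ (rot (toℕ t) v′) j ⊕_) (sym (φ-rot-t′ j))))))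

    t-part : (toℕ t′ + r) mod b ≡ (toℕ t + (r′ + r)) mod b
    t-part = mod-cong (≡ₘ-trans (+-cong-≡ₘ (toℕ-mod (toℕ t + r′)) ≡ₘ-refl) (≡ₘ-reflexive (+-assoc (toℕ t) r′ r)))

  act-fixes : ∀ {r} v w t → r ≡ₘ 0 → φ (rot (toℕ t) v) ≈ᵛ 0ᵛ → act (r , v) (w , t) ≈ₚ (w , t)
  act-fixes v w t r≡0 φv≈0 =
    (λ j → trans (cong (w j ⊕_) (φv≈0 j)) (⊕-identityʳ (w j))) ,
    mod-toℕ (≡ₘ-trans (+-cong-≡ₘ ≡ₘ-refl r≡0) (≡ₘ-reflexive (+-identityʳ (toℕ t))))

  act-trivial : ∀ {r v} → r ≡ₘ 0 → v ≈ᵛ 0ᵛ → ∀ x → act (r , v) x ≈ₚ x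
  act-trivial {v = v} r≡0 v≈0 (w , t) =
    act-fixes v w t r≡0 λ j → trans (≈-cong φ-linear (λ i → v≈0 _) j) (0-homo φ-linear j)

  act-ε : ∀ x → act ε x ≈ₚ x
  act-ε = act-trivial ≡ₘ-refl λ _ → refl

  act-⁻¹∙ : ∀ g x → act (g ⁻¹ ∙ g) x ≈ₚ x
  act-⁻¹∙ (r , v) = act-trivial (m+m*b′≡ₘ0 r)
    λ i → trans (cong (λ t → v i ⊕ ⊖ t) (rot-rot-inverse r v i)) (⊖-inverseʳ (v i))

  act-∙⁻¹ : ∀ g x → act (g ∙ g ⁻¹) x ≈ₚ x
  act-∙⁻¹ (r , v) = act-trivial (≡ₘ-trans (≡ₘ-reflexive (+-comm (r * b′) r)) (m+m*b′≡ₘ0 r))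
    λ i → ⊖-inverseˡ (rot (r * b′) v i)

  act-transitive : (∀ z → Σ (V b) λ x → φ x ≈ᵛ z) → ∀ x y → Σ Element λ g → act g x ≈ₚ y
  act-transitive φ-surjective (w , t) (w′ , t′) = (toℕ t * b′ + toℕ t′ , rot (toℕ t * b′) z) , w-part , t-part
    where
    z = proj₁ (φ-surjective (w′ +ᵛ -ᵛ w))

    w-part : ∀ j → w j ⊕ φ (rot (toℕ t) (rot (toℕ t * b′) z)) j ≡ w′ j
    w-part j = trans (cong (w j ⊕_) (trans (≈-cong φ-linear (rot-rot-inverse (toℕ t) z) j) (proj₂ (φ-surjective _) j)))
                     (a⊕[b⊕⊖a]≡b (w j) (w′ j))

    t-part : (toℕ t + (toℕ t * b′ + toℕ t′)) mod b ≡ t′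
    t-part = mod-toℕ (≡ₘ-trans (≡ₘ-reflexive (sym (+-assoc (toℕ t) _ (toℕ t′)))) (+-cong-≡ₘ (m+m*b′≡ₘ0 (toℕ t)) ≡ₘ-refl))

  N : ℕ
  N = p ^ k * b

  encode : Point → Fin N
  encode (w , t) = combine (funToFin w) t

  decode : Fin N → Point
  decode i = finToFun (quotient b i) , remainder {p ^ k} b i

  encode-cong : ∀ {x y} → x ≈ₚ y → encode x ≡ encode y
  encode-cong (w≈w′ , refl) = cong₂ combine (funToFin-cong w≈w′) refl

  encode-decode : ∀ i → encode (decode i) ≡ i
  encode-decode i = trans (cong₂ combine (funToFin-finToFin {k} {p} (quotient b i)) refl) (combine-remQuot {p ^ k} b i)

  decode-encode : ∀ x → decode (encode x) ≈ₚ x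
  decode-encode (w , t) =
    (λ j → trans (cong (λ q → finToFun q j) (cong proj₁ (remQuot-combine (funToFin w) t))) (finToFun-funToFin w j)) ,
    cong proj₂ (remQuot-combine {p ^ k} {b} (funToFin w) t)

  ⟦_⟧ : Element → Fin N → Fin N
  ⟦ g ⟧ i = encode (act g (decode i))

  ⟦⟧-∙ : ∀ g h i → ⟦ g ⟧ (⟦ h ⟧ i) ≡ ⟦ g ∙ h ⟧ i
  ⟦⟧-∙ g h i = encode-cong (≈ₚ-trans (act-cong g (decode-encode _)) (act-∙ g h (decode i)))

  ⟦⟧-trivial : ∀ g → (∀ x → act g x ≈ₚ x) → ∀ i → ⟦ g ⟧ i ≡ i
  ⟦⟧-trivial _ g-trivial i = trans (encode-cong (g-trivial (decode i))) (encode-decode i)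

  ⟦⁻¹⟧-⟦⟧ : ∀ g i → ⟦ g ⁻¹ ⟧ (⟦ g ⟧ i) ≡ i
  ⟦⁻¹⟧-⟦⟧ g i = trans (⟦⟧-∙ (g ⁻¹) g i) (⟦⟧-trivial (g ⁻¹ ∙ g) (act-⁻¹∙ g) i)

  ⟦⟧-⟦⁻¹⟧ : ∀ g i → ⟦ g ⟧ (⟦ g ⁻¹ ⟧ i) ≡ i
  ⟦⟧-⟦⁻¹⟧ g i = trans (⟦⟧-∙ g (g ⁻¹) i) (⟦⟧-trivial (g ∙ g ⁻¹) (act-∙⁻¹ g) i)

  toPermutation : Element → Permutation′ N
  toPermutation g = permutation ⟦ g ⟧ ⟦ g ⁻¹ ⟧ (⟦⟧-⟦⁻¹⟧ g) (⟦⁻¹⟧-⟦⟧ g)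

  G : Permutation′ N → Set
  G π = Σ Element λ g → ∀ i → π ⟨$⟩ʳ i ≡ ⟦ g ⟧ i

  G-isPermGroup : IsPermGroup G
  G-isPermGroup = record
    { respects  = λ { π≗ρ (g , π≗g) → g , λ i → trans (sym (π≗ρ i)) (π≗g i) }
    ; has-id    = toPermutation ε , (ε , λ _ → refl) , ⟦⟧-trivial ε act-ε
    ; closed-∘  = λ { {π} {ρ} (g , π≗g) (h , ρ≗h) → toPermutation (g ∙ h) , (g ∙ h , λ _ → refl) ,
                      λ i → sym (trans (π≗g _) (trans (cong ⟦ g ⟧ (ρ≗h i)) (⟦⟧-∙ g h i))) }
    ; closed-⁻¹ = λ { {π} (g , π≗g) → toPermutation (g ⁻¹) , (g ⁻¹ , λ _ → refl) ,
                      λ i → trans (cong ⟦ g ⁻¹ ⟧ (trans (sym (inverseʳ π)) (π≗g _))) (⟦⁻¹⟧-⟦⟧ g (π ⟨$⟩ˡ i)) }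
    }

  G-isTransitive : (∀ z → Σ (V b) λ x → φ x ≈ᵛ z) → IsTransitive G
  G-isTransitive φ-surjective i j =
    toPermutation g , (g , λ _ → refl) , trans (encode-cong (proj₂ g-moves)) (encode-decode j)
    where
    g-moves = act-transitive φ-surjective (decode i) (decode j)
    g = proj₁ g-moves

  iter-⟦⟧-position : ∀ r v m i →
    toℕ (proj₂ (decode (iter ⟦ r , v ⟧ m i))) ≡ₘ toℕ (proj₂ (decode i)) + m * r
  iter-⟦⟧-position r v zero    i = ≡ₘ-reflexive (sym (+-identityʳ _))
  iter-⟦⟧-position r v (suc m) i = begin
    toℕ (proj₂ (decode (⟦ r , v ⟧ x)))                ≡⟨ cong toℕ (proj₂ (decode-encode (act (r , v) (decode x)))) ⟩
    toℕ ((toℕ (proj₂ (decode x)) + r) mod b)          ≈⟨ toℕ-mod _ ⟩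
    toℕ (proj₂ (decode x)) + r                        ≈⟨ +-cong-≡ₘ (iter-⟦⟧-position r v m i) ≡ₘ-refl ⟩
    toℕ (proj₂ (decode i)) + m * r + r                ≡⟨ +-assoc (toℕ (proj₂ (decode i))) (m * r) r ⟩
    toℕ (proj₂ (decode i)) + (m * r + r)              ≡⟨ cong (toℕ (proj₂ (decode i)) +_) (+-comm (m * r) r) ⟩
    toℕ (proj₂ (decode i)) + suc m * r                ∎
    where
    open ≡ₘ-Reasoning
    x = iter ⟦ r , v ⟧ m i

  module _ (U : V b → Set) (U-covering : CyclicallyCovering p U) (φ-kills-U : ∀ u → U u → φ u ≈ᵛ 0ᵛ) where

    rotation-into-kernel : ∀ v → Σ (Fin b) λ t → φ (rot (toℕ t) v) ≈ᵛ 0ᵛ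
    rotation-into-kernel v with U-covering v
    ... | s , _ , u , u∈U , v≈σˢu = s mod b , λ j → trans (≈-cong φ-linear rot-v≈u j) (φ-kills-U u u∈U j)
      where
      rot-v≈u : rot (toℕ (s mod b)) v ≈ᵛ u
      rot-v≈u i = trans (rot-≡ₘ v (toℕ-mod s) i)
                  (trans (v≈σˢu _) (trans (σ^-rot s u _) (rot-rot-inverse s u i)))

    pPowerOrder⇒¬fixedPointFree : Coprime b p → ∀ π → G π → HasPPowerOrder p π → ¬ FixedPointFree π
    pPowerOrder⇒¬fixedPointFree b⊥p π ((r , v) , π≗g) (a , _ , πᵖᵃ≗id , _) π-fpf = π-fpf (encode (0ᵛ , t)) π-fixes
      where
      i₀ = encode (0ᵛ , zero)

      pᵃr≡ₘ0 : p ^ a * r ≡ₘ 0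
      pᵃr≡ₘ0 = ≡ₘ-sym (begin
        0                                                  ≡⟨ cong toℕ (proj₂ (decode-encode (0ᵛ , zero))) ⟨
        toℕ (proj₂ (decode i₀))                            ≡⟨ cong (λ i → toℕ (proj₂ (decode i))) (πᵖᵃ≗id i₀) ⟨
        toℕ (proj₂ (decode (iter (π ⟨$⟩ʳ_) (p ^ a) i₀)))  ≡⟨ cong (λ i → toℕ (proj₂ (decode i))) (iter-cong π≗g (p ^ a) i₀) ⟩
        toℕ (proj₂ (decode (iter ⟦ r , v ⟧ (p ^ a) i₀)))   ≈⟨ iter-⟦⟧-position r v (p ^ a) i₀ ⟩
        toℕ (proj₂ (decode i₀)) + p ^ a * r               ≡⟨ cong (λ t → toℕ t + p ^ a * r) (proj₂ (decode-encode (0ᵛ , zero))) ⟩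
        p ^ a * r                                          ∎)
        where open ≡ₘ-Reasoning

      r≡ₘ0 : r ≡ₘ 0
      r≡ₘ0 = ∣⇒≡ₘ0 (coprime-divisor-^ b⊥p a (≡ₘ0⇒∣ pᵃr≡ₘ0))

      t = proj₁ (rotation-into-kernel v)

      π-fixes : π ⟨$⟩ʳ encode (0ᵛ , t) ≡ encode (0ᵛ , t)
      π-fixes = trans (π≗g _) (encode-cong (≈ₚ-trans (act-cong (r , v) (decode-encode (0ᵛ , t)))
                                                     (act-fixes v 0ᵛ t r≡ₘ0 (proj₂ (rotation-into-kernel v)))))

    p^k*b∈A : Coprime b p → (∀ z → Σ (V b) λ x → φ x ≈ᵛ z) → InA p N
    p^k*b∈A b⊥p φ-surjective =
      >-nonZero⁻¹ N {{m*n≢0 (p ^ k) b {{m^n≢0 p k}}}} , G , G-isPermGroup , G-isTransitive φ-surjective ,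
      pPowerOrder⇒¬fixedPointFree b⊥p

covering-subspace⇒p^k*b∈A : ∀ p (pp : Prime p) b′ k → Coprime (suc b′) p →
                            CoveringCodim p {{prime⇒nonZero pp}} (suc b′) k → InA p (p ^ k * suc b′)
covering-subspace⇒p^k*b∈A p pp b′ k b⊥p (U , _ , U-covering , d , (v , v-basis) , d+k≡b) =
  p^k*b∈A U U-covering φ-kills-U b⊥p surjective
  where
  open PrimeField p pp using (p≢0)
  open LinearAlgebra p pp
  open QuotientMap (quotientMap d k d+k≡b v (IsBasis.independent v-basis))
  open AffineAction p pp b′ k map linear

  φ-kills-U : ∀ u → U u → map u ≈ᵛ 0ᵛ
  φ-kills-U u u∈U j = trans (≈-cong linear (proj₂ u∈span) j) (kills-span (proj₁ u∈span) j)
    where u∈span = IsBasis.spanning v-basis u u∈U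

proposition1p1 : ∀ (p : ℕ) (pp : Prime p) (b : ℕ) → Coprime b p →
    ∀ (k : ℕ) → CoveringCodim p {{prime⇒nonZero pp}} b k →
    ∀ (c : ℕ) → (∀ (a : ℕ) → c ≤ a → ¬ InA p (p ^ a * b)) →
    k < c
proposition1p1 p pp zero b⊥p k _ c _ = ⊥-elim (¬prime[1] (subst Prime (b⊥p (p ∣0 , ∣-refl)) pp))
proposition1p1 p pp (suc b′) b⊥p k covering c p^ab∉A with c ≤? k
... | no c≰k  = ≰⇒> c≰k
... | yes c≤k = ⊥-elim (p^ab∉A k c≤k (covering-subspace⇒p^k*b∈A p pp b′ k b⊥p covering))
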